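{- Let $(C_4,\sigma)$ be the signed $4$-cycle $v_1v_2v_3v_4$ (in cyclic order) in which $v_3v_4$ is the only positive edge. Let $\mathcal L$ be a list assignment where $L(v_1)$ and $L(v_2)$ are intervals of length $7$ and $L(v_3)$ and $L(v_4)$ are intervals of length $5$. Then $(C_4,\sigma)$ is $\mathcal L$-colorable.
   Context: Colors are the vertices of $K^s_{10;3}$, written $\pm[5]=\{\pm1,\dots,\pm5\}$ in the cyclic order $1,2,3,4,5,-1,-2,-3,-4,-5$; two colors are joined by a positive edge iff their cyclic distance is at most $2$ (including equal colors) and by a negative edge iff their cyclic distance is at least $3$. An interval of length $k$ is a set of $k$ cyclically consecutive colors. An $\mathcal L$-coloring is a map $\phi$ with $\phi(v)\in L(v)$ such that for every edge $xy$ of sign $s$, $\phi(x)\phi(y)$ is an edge of $K^s_{10;3}$ of sign $s$. -}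

module Defs where

open import Data.Nat using (ℕ; _+_; _∸_; _≤_; _<_; _⊓_)
open import Data.Nat.DivMod using (_%_; m%n<n)
open import Data.Fin using (Fin; toℕ; fromℕ<; zero; suc)
open import Data.Fin.Subset using (Subset; _∈_)
open import Data.Product using (Σ; ∃; _×_)
open import Relation.Binary.PropositionalEquality using (_≡_)
open import Function.Bundles using (_⇔_)

-- Colors ±[5] are encoded by their position in the cyclic order
-- 1,2,3,4,5,-1,-2,-3,-4,-5 : position i ∈ Fin 10
-- (0..4 ↦ 1..5, 5..9 ↦ -1..-5).
Color : Set
Color = Fin 10

shift : Color → ℕ → Color
shift c j = fromℕ< (m%n<n (toℕ c + j) 10)

absDiff : ℕ → ℕ → ℕ
absDiff a b = (a ∸ b) + (b ∸ a)

cdist : Color → Color → ℕ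
cdist a b = absDiff (toℕ a) (toℕ b) ⊓ (10 ∸ absDiff (toℕ a) (toℕ b))

PosEdge : Color → Color → Set
PosEdge a b = cdist a b ≤ 2

NegEdge : Color → Color → Set
NegEdge a b = 3 ≤ cdist a b

IsInterval : ℕ → Subset 10 → Set
IsInterval k S = ∃ λ (s : Color) → ∀ (c : Color) →
  (c ∈ S) ⇔ (∃ λ (j : ℕ) → (j < k) × (c ≡ shift s j))

v₁ v₂ v₃ v₄ : Fin 4
v₁ = zero
v₂ = suc zero
v₃ = suc (suc zero)
v₄ = suc (suc (suc zero))

IsLColoring : (Fin 4 → Subset 10) → (Fin 4 → Color) → Set
IsLColoring L φ =
  (∀ v → φ v ∈ L v)
  × NegEdge (φ v₁) (φ v₂)
  × NegEdge (φ v₂) (φ v₃)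
  × PosEdge (φ v₃) (φ v₄)
  × NegEdge (φ v₄) (φ v₁)

{-# OPTIONS --safe #-}
module Submission where

-- Rotating the color cycle preserves the cyclic distance, hence both edge relations, so we may
-- assume that L(v₁) starts at the color in position 0. For the remaining 10³ positions of the
-- other three intervals an exhaustive search finds offsets into the four intervals that give a
-- coloring.

open import Defs
open import Data.Fin.Subset using (Subset; _∈_)
open import Data.Fin using (Fin; toℕ; zero; suc)
open import Data.Fin.Properties using (toℕ-fromℕ<; toℕ<n; toℕ-injective; any?; all?)
open import Data.Nat using (suc; NonZero; _+_; _∸_; _%_; _≤_; _≤?_; _≟_)
open import Data.Nat.DivMod using (%-distribˡ-+; m%n%n≡m%n; m<n⇒m%n≡m)
open import Data.Nat.Properties using (+-assoc; +-comm; +-identityʳ; <⇒≤; m+[n∸m]≡n)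
open import Data.Product using (∃; _×_; _,_; proj₁)
open import Function.Bundles using (Equivalence)
open import Relation.Binary.PropositionalEquality
  using (_≡_; refl; sym; cong; cong₂; subst; module ≡-Reasoning)
open import Relation.Nullary.Decidable using (Dec; _×-dec_; toWitness)

open ≡-Reasoning

[m%d+n]%d≡[m+n]%d : ∀ m n d .{{_ : NonZero d}} → (m % d + n) % d ≡ (m + n) % d
[m%d+n]%d≡[m+n]%d m n d = begin
  (m % d + n) % d           ≡⟨ %-distribˡ-+ (m % d) n d ⟩
  (m % d % d + n % d) % d   ≡⟨ cong (λ x → (x + n % d) % d) (m%n%n≡m%n m d) ⟩
  (m % d + n % d) % d       ≡⟨ %-distribˡ-+ m n d ⟨
  (m + n) % d               ∎

toℕ-shift : ∀ c j → toℕ (shift c j) ≡ (toℕ c + j) % 10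
toℕ-shift c j = toℕ-fromℕ< _

shift-identityʳ : ∀ c → shift c 0 ≡ c
shift-identityʳ c = toℕ-injective (begin
  toℕ (shift c 0)    ≡⟨ toℕ-shift c 0 ⟩
  (toℕ c + 0) % 10   ≡⟨ cong (_% 10) (+-identityʳ (toℕ c)) ⟩
  toℕ c % 10         ≡⟨ m<n⇒m%n≡m (toℕ<n c) ⟩
  toℕ c              ∎)

shift-+ : ∀ c j k → shift (shift c j) k ≡ shift c (j + k)
shift-+ c j k = toℕ-injective (begin
  toℕ (shift (shift c j) k)   ≡⟨ toℕ-shift (shift c j) k ⟩
  (toℕ (shift c j) + k) % 10  ≡⟨ cong (λ x → (x + k) % 10) (toℕ-shift c j) ⟩
  ((toℕ c + j) % 10 + k) % 10 ≡⟨ [m%d+n]%d≡[m+n]%d (toℕ c + j) k 10 ⟩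
  (toℕ c + j + k) % 10        ≡⟨ cong (_% 10) (+-assoc (toℕ c) j k) ⟩
  (toℕ c + (j + k)) % 10      ≡⟨ toℕ-shift c (j + k) ⟨
  toℕ (shift c (j + k))       ∎)

shift-comm : ∀ c j k → shift (shift c j) k ≡ shift (shift c k) j
shift-comm c j k = begin
  shift (shift c j) k   ≡⟨ shift-+ c j k ⟩
  shift c (j + k)       ≡⟨ cong (shift c) (+-comm j k) ⟩
  shift c (k + j)       ≡⟨ shift-+ c k j ⟨
  shift (shift c k) j   ∎

shift-complement : ∀ c → shift c (10 ∸ toℕ c) ≡ zero
shift-complement c = toℕ-injective (begin
  toℕ (shift c (10 ∸ toℕ c))      ≡⟨ toℕ-shift c (10 ∸ toℕ c) ⟩
  (toℕ c + (10 ∸ toℕ c)) % 10     ≡⟨ cong (_% 10) (m+[n∸m]≡n (<⇒≤ (toℕ<n c))) ⟩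
  10 % 10                         ∎)

cdist-shift₁ : ∀ a b → cdist (shift a 1) (shift b 1) ≡ cdist a b
cdist-shift₁ = toWitness {a? = all? λ a → all? λ b → cdist (shift a 1) (shift b 1) ≟ cdist a b} _

cdist-shift : ∀ a b k → cdist (shift a k) (shift b k) ≡ cdist a b
cdist-shift a b 0       = cong₂ cdist (shift-identityʳ a) (shift-identityʳ b)
cdist-shift a b (suc k) = begin
  cdist (shift a (1 + k)) (shift b (1 + k))           ≡⟨ cong₂ cdist (shift-+ a 1 k) (shift-+ b 1 k) ⟨
  cdist (shift (shift a 1) k) (shift (shift b 1) k)   ≡⟨ cdist-shift (shift a 1) (shift b 1) k ⟩
  cdist (shift a 1) (shift b 1)                       ≡⟨ cdist-shift₁ a b ⟩
  cdist a b                                           ∎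

offset : ∀ {k} → Color → Fin k → Color
offset s j = shift s (toℕ j)

offset-∈ : ∀ {k S} (I : IsInterval k S) (j : Fin k) → offset (proj₁ I) j ∈ S
offset-∈ (s , S≡) j = Equivalence.from (S≡ _) (toℕ j , toℕ<n j , refl)

offset-shift : ∀ {k} s r (j : Fin k) → offset (shift s r) j ≡ shift (offset s j) r
offset-shift s r j = shift-comm s r (toℕ j)

cdist-offset-shift : ∀ {k l} a b r (i : Fin k) (j : Fin l) →
                     cdist (offset (shift a r) i) (offset (shift b r) j) ≡ cdist (offset a i) (offset b j)
cdist-offset-shift a b r i j = begin
  cdist (offset (shift a r) i) (offset (shift b r) j)   ≡⟨ cong₂ cdist (offset-shift a r i) (offset-shift b r j) ⟩
  cdist (shift (offset a i) r) (shift (offset b j) r)   ≡⟨ cdist-shift (offset a i) (offset b j) r ⟩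
  cdist (offset a i) (offset b j)                       ∎

-- The quantifiers are nested so that ColorableFrom? discards a partial choice as soon as it fails.
ColorableFrom : Color → Color → Color → Color → Set
ColorableFrom s₁ s₂ s₃ s₄ =
  ∃ λ (j₃ : Fin 5) → ∃ λ (j₄ : Fin 5) → PosEdge (offset s₃ j₃) (offset s₄ j₄) ×
  ∃ λ (j₁ : Fin 7) → NegEdge (offset s₄ j₄) (offset s₁ j₁) ×
  ∃ λ (j₂ : Fin 7) → NegEdge (offset s₁ j₁) (offset s₂ j₂) × NegEdge (offset s₂ j₂) (offset s₃ j₃)

PosEdge? : ∀ a b → Dec (PosEdge a b)
PosEdge? a b = cdist a b ≤? 2

NegEdge? : ∀ a b → Dec (NegEdge a b)
NegEdge? a b = 3 ≤? cdist a b

ColorableFrom? : ∀ s₁ s₂ s₃ s₄ → Dec (ColorableFrom s₁ s₂ s₃ s₄)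
ColorableFrom? s₁ s₂ s₃ s₄ =
  any? λ j₃ → any? λ j₄ → PosEdge? (offset s₃ j₃) (offset s₄ j₄) ×-dec
  any? λ j₁ → NegEdge? (offset s₄ j₄) (offset s₁ j₁) ×-dec
  any? λ j₂ → NegEdge? (offset s₁ j₁) (offset s₂ j₂) ×-dec NegEdge? (offset s₂ j₂) (offset s₃ j₃)

colorableFrom-zero : ∀ s₂ s₃ s₄ → ColorableFrom zero s₂ s₃ s₄
colorableFrom-zero = toWitness {a? = all? λ s₂ → all? λ s₃ → all? λ s₄ → ColorableFrom? zero s₂ s₃ s₄} _

ColorableFrom-unshift : ∀ s₁ s₂ s₃ s₄ r →
  ColorableFrom (shift s₁ r) (shift s₂ r) (shift s₃ r) (shift s₄ r) → ColorableFrom s₁ s₂ s₃ s₄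
ColorableFrom-unshift s₁ s₂ s₃ s₄ r (j₃ , j₄ , e₃₄ , j₁ , e₄₁ , j₂ , e₁₂ , e₂₃) =
  j₃ , j₄ , subst (_≤ 2) (cdist-offset-shift s₃ s₄ r j₃ j₄) e₃₄ ,
  j₁ , subst (3 ≤_) (cdist-offset-shift s₄ s₁ r j₄ j₁) e₄₁ ,
  j₂ , subst (3 ≤_) (cdist-offset-shift s₁ s₂ r j₁ j₂) e₁₂ ,
       subst (3 ≤_) (cdist-offset-shift s₂ s₃ r j₂ j₃) e₂₃

colorableFrom : ∀ s₁ s₂ s₃ s₄ → ColorableFrom s₁ s₂ s₃ s₄
colorableFrom s₁ s₂ s₃ s₄ = ColorableFrom-unshift s₁ s₂ s₃ s₄ r
  (subst (λ t → ColorableFrom t (shift s₂ r) (shift s₃ r) (shift s₄ r)) (sym (shift-complement s₁))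
         (colorableFrom-zero (shift s₂ r) (shift s₃ r) (shift s₄ r)))
  where r = 10 ∸ toℕ s₁

lemma2p10 : (L : Fin 4 → Subset 10) →
    IsInterval 7 (L v₁) → IsInterval 7 (L v₂) →
    IsInterval 5 (L v₃) → IsInterval 5 (L v₄) →
    ∃ λ (φ : Fin 4 → Color) → IsLColoring L φ
lemma2p10 L (s₁ , L₁) (s₂ , L₂) (s₃ , L₃) (s₄ , L₄) = coloring (colorableFrom s₁ s₂ s₃ s₄)
  where
  coloring : ColorableFrom s₁ s₂ s₃ s₄ → ∃ λ φ → IsLColoring L φ
  coloring (j₃ , j₄ , e₃₄ , j₁ , e₄₁ , j₂ , e₁₂ , e₂₃) = φ , φ∈L , e₁₂ , e₂₃ , e₃₄ , e₄₁
    where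
    φ : Fin 4 → Color
    φ zero                   = offset s₁ j₁
    φ (suc zero)             = offset s₂ j₂
    φ (suc (suc zero))       = offset s₃ j₃
    φ (suc (suc (suc zero))) = offset s₄ j₄

    φ∈L : ∀ v → φ v ∈ L v
    φ∈L zero                   = offset-∈ (s₁ , L₁) j₁
    φ∈L (suc zero)             = offset-∈ (s₂ , L₂) j₂
    φ∈L (suc (suc zero))       = offset-∈ (s₃ , L₃) j₃
    φ∈L (suc (suc (suc zero))) = offset-∈ (s₄ , L₄) j₄
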